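{- The rewriting system $\upsilon'$ is locally confluent (hence, confluent) on the set of well-formed terms.
   Context: Named variables $x,y,z,\ldots$ ($\mathsf{x}$ ranges over them). Terms and substitutions: $a,b::=\mathsf{x}\mid\underline{1}\mid ab\mid\lambda a\mid a[s]$, $s::=b/\mid\,\uparrow\,\mid id\mid\,\Uparrow\! s$; $a[s][t]$ means $(a[s])[t]$. The system $\upsilon'$ consists of the following rules applicable to any subterm (including inside $b/$ and $\Uparrow\! s$): (App) $(ab)[s]\to(a[s])(b[s])$; (Lambda) $(\lambda a)[s]\to\lambda(a[\Uparrow\! s])$; (Var) $\underline{1}[b/]\to b$; (Shift) $a[\uparrow][b/]\to a$; (VarId) $\underline{1}[id]\to\underline{1}$; (ShiftId) $a[\uparrow][id]\to a[\uparrow]$; (VarLift) $\underline{1}[\Uparrow\! s]\to\underline{1}$; (ShiftLift) $a[\uparrow][\Uparrow\! s]\to a[s][\uparrow]$. Judgements $n\vdash a$ and $n\vdash s\triangleright m$ ($n,m\in\mathbb{N}$) are derived by: $0\vdash\mathsf{x}$; $n+1\vdash\underline{1}$; from $n\vdash a$, $n\vdash b$ infer $n\vdash ab$; from $n+1\vdash a$ infer $n\vdash\lambda a$; from $n\vdash s\triangleright m$, $m\vdash a$ infer $n\vdash a[s]$; from $n\vdash b$ infer $n\vdash b/\triangleright n+1$; $n+1\vdash\,\uparrow\triangleright n$; $n+1\vdash id\triangleright n+1$; from $n\vdash s\triangleright m$ infer $n+1\vdash\,\Uparrow\! s\triangleright m+1$. A term $a$ is well-formed iff $n\vdash a$ is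 derivable for some $n$. Local confluence on well-formed terms: for every well-formed $a$ with $a\to b$ and $a\to c$ by one $\upsilon'$-step each, $b$ and $c$ have a common $\upsilon'$-reduct. -}

module Defs where

open import Data.Nat using (ℕ; zero; suc)
open import Data.Product using (∃; _×_)
open import Relation.Binary.Construct.Closure.ReflexiveTransitive using (Star)

-- Named variables are represented by natural numbers (a countable supply of names).
Name : Set
Name = ℕ

mutual
  data Term : Set where
    var  : Name → Term
    one  : Term
    app  : Term → Term → Term
    lam  : Term → Term
    _[_] : Term → Subst → Term

  data Subst : Set where
    _/  : Term → Subst
    ↑   : Subst
    id  : Subst
    ⇑_  : Subst → Subst

infixl 8 _[_]
infix 4 _⟶_ _⟶ˢ_ _⟶*_ _⊢_ _⊢_▷_
infix 9 _/
infix 9 ⇑_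

mutual
  data _⟶_ : Term → Term → Set where
    rApp       : ∀ {a b s} → (app a b) [ s ] ⟶ app (a [ s ]) (b [ s ])
    rLambda    : ∀ {a s} → (lam a) [ s ] ⟶ lam (a [ ⇑ s ])
    rVar       : ∀ {b} → one [ b / ] ⟶ b
    rShift     : ∀ {a b} → a [ ↑ ] [ b / ] ⟶ a
    rVarId     : one [ id ] ⟶ one
    rShiftId   : ∀ {a} → a [ ↑ ] [ id ] ⟶ a [ ↑ ]
    rVarLift   : ∀ {s} → one [ ⇑ s ] ⟶ one
    rShiftLift : ∀ {a s} → a [ ↑ ] [ ⇑ s ] ⟶ a [ s ] [ ↑ ]
    cAppL  : ∀ {a a' b} → a ⟶ a' → app a b ⟶ app a' b
    cAppR  : ∀ {a b b'} → b ⟶ b' → app a b ⟶ app a b'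
    cLam   : ∀ {a a'} → a ⟶ a' → lam a ⟶ lam a'
    cClosL : ∀ {a a' s} → a ⟶ a' → a [ s ] ⟶ a' [ s ]
    cClosR : ∀ {a s s'} → s ⟶ˢ s' → a [ s ] ⟶ a [ s' ]

  data _⟶ˢ_ : Subst → Subst → Set where
    cSlash : ∀ {b b'} → b ⟶ b' → (b /) ⟶ˢ (b' /)
    cLift  : ∀ {s s'} → s ⟶ˢ s' → (⇑ s) ⟶ˢ (⇑ s')

_⟶*_ : Term → Term → Set
_⟶*_ = Star _⟶_

mutual
  data _⊢_ : ℕ → Term → Set where
    wVar : ∀ {x} → 0 ⊢ var x
    wOne : ∀ {n} → suc n ⊢ one
    wApp : ∀ {n a b} → n ⊢ a → n ⊢ b → n ⊢ app a b
    wLam : ∀ {n a} → suc n ⊢ a → n ⊢ lam a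
    wClos : ∀ {n m a s} → n ⊢ s ▷ m → m ⊢ a → n ⊢ a [ s ]

  data _⊢_▷_ : ℕ → Subst → ℕ → Set where
    wSlash : ∀ {n b} → n ⊢ b → n ⊢ (b /) ▷ suc n
    wShift : ∀ {n} → suc n ⊢ ↑ ▷ n
    wId    : ∀ {n} → suc n ⊢ id ▷ suc n
    wLift  : ∀ {n m s} → n ⊢ s ▷ m → suc n ⊢ ⇑ s ▷ suc m

WellFormed : Term → Set
WellFormed a = ∃ λ n → n ⊢ a

module Submission where

-- Every peak b ⟵ a ⟶ c is either made of two steps in disjoint or nested
-- positions, which commute in at most one step each, or is a critical pair in
-- which one step is a root step.  All critical pairs close directly except the
-- three where Shift, ShiftId or ShiftLift overlaps with Lambda on the inner
-- closure (λa)[↑].  Closing those requires pushing the substitutions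
-- ⇑↑ and ⇑(b/), ⇑id, ⇑s through the body a, which is only possible once a has
-- been normalised.

open import Defs
open import Data.Nat using (ℕ; zero; suc; _+_)
open import Data.Product using (∃; _×_; _,_)
open import Relation.Binary.Construct.Closure.ReflexiveTransitive
  using (Star; ε; _◅_; _◅◅_; gmap; return)

_⟶ˢ*_ : Subst → Subst → Set
_⟶ˢ*_ = Star _⟶ˢ_

appL* : ∀ {a a' b} → a ⟶* a' → app a b ⟶* app a' b
appL* {b = b} = gmap (λ x → app x b) cAppL

appR* : ∀ {a b b'} → b ⟶* b' → app a b ⟶* app a b'
appR* {a = a} = gmap (app a) cAppR

app* : ∀ {a a' b b'} → a ⟶* a' → b ⟶* b' → app a b ⟶* app a' b'
app* p q = appL* p ◅◅ appR* q

lam* : ∀ {a a'} → a ⟶* a' → lam a ⟶* lam a'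
lam* = gmap lam cLam

closL* : ∀ {a a' s} → a ⟶* a' → a [ s ] ⟶* a' [ s ]
closL* {s = s} = gmap (λ x → x [ s ]) cClosL

closR* : ∀ {a s s'} → s ⟶ˢ* s' → a [ s ] ⟶* a [ s' ]
closR* {a = a} = gmap (λ t → a [ t ]) cClosR

slash* : ∀ {b b'} → b ⟶* b' → (b /) ⟶ˢ* (b' /)
slash* = gmap _/ cSlash

lift* : ∀ {s s'} → s ⟶ˢ* s' → (⇑ s) ⟶ˢ* (⇑ s')
lift* = gmap ⇑_ cLift

Join : Term → Term → Set
Join b c = ∃ λ d → (b ⟶* d) × (c ⟶* d)

join-sym : ∀ {b c} → Join b c → Join c b
join-sym (d , p , q) = d , q , p

join-expand : ∀ {a a' b b'} → a ⟶* a' → b ⟶* b' → Join a' b' → Join a b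
join-expand p q (d , p' , q') = d , p ◅◅ p' , q ◅◅ q'

join-lam : ∀ {a b} → Join a b → Join (lam a) (lam b)
join-lam (d , p , q) = lam d , lam* p , lam* q

data NF : ℕ → Term → Set where
  nVar : ∀ {x} → NF 0 (var x)
  nOne : ∀ {n} → NF (suc n) one
  nApp : ∀ {n a b} → NF n a → NF n b → NF n (app a b)
  nLam : ∀ {n a} → NF (suc n) a → NF n (lam a)
  nSh  : ∀ {n a} → NF n a → NF (suc n) (a [ ↑ ])

data NFˢ : ℕ → Subst → ℕ → Set where
  sSlash : ∀ {n b} → NF n b → NFˢ n (b /) (suc n)
  sShift : ∀ {n} → NFˢ (suc n) ↑ n
  sId    : ∀ {n} → NFˢ (suc n) id (suc n)
  sLift  : ∀ {n m s} → NFˢ n s m → NFˢ (suc n) (⇑ s) (suc m)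

Normalises : ℕ → Term → Set
Normalises n a = ∃ λ a' → (a ⟶* a') × NF n a'

substitute : ∀ {n m a s} → NF m a → NFˢ n s m → Normalises n (a [ s ])
substitute nVar        sShift      = _ , ε , nSh nVar
substitute nOne        (sSlash nb) = _ , return rVar , nb
substitute nOne        sShift      = _ , ε , nSh nOne
substitute nOne        sId         = _ , return rVarId , nOne
substitute nOne        (sLift _)   = _ , return rVarLift , nOne
substitute (nApp na nb) ns =
  let (_ , ra , na') = substitute na ns
      (_ , rb , nb') = substitute nb ns
  in  _ , rApp ◅ app* ra rb , nApp na' nb'
substitute (nLam na) ns =
  let (_ , r , na') = substitute na (sLift ns)
  in  _ , rLambda ◅ lam* r , nLam na'
substitute (nSh na) (sSlash _) = _ , return rShift , na
substitute (nSh na) sShift     = _ , ε , nSh (nSh na)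
substitute (nSh na) sId        = _ , return rShiftId , nSh na
substitute (nSh na) (sLift ns) =
  let (_ , r , na') = substitute na ns
  in  _ , rShiftLift ◅ closL* r , nSh na'

mutual
  normalise : ∀ {n a} → n ⊢ a → Normalises n a
  normalise wVar = _ , ε , nVar
  normalise wOne = _ , ε , nOne
  normalise (wApp wa wb) =
    let (_ , ra , na) = normalise wa
        (_ , rb , nb) = normalise wb
    in  _ , app* ra rb , nApp na nb
  normalise (wLam wa) =
    let (_ , r , na) = normalise wa
    in  _ , lam* r , nLam na
  normalise (wClos ws wa) =
    let (_ , rs , ns) = normaliseˢ ws
        (_ , ra , na) = normalise wa
        (_ , r  , ne) = substitute na ns
    in  _ , closL* ra ◅◅ closR* rs ◅◅ r , ne

  normaliseˢ : ∀ {n s m} → n ⊢ s ▷ m → ∃ λ s' → (s ⟶ˢ* s') × NFˢ n s' m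
  normaliseˢ (wSlash wb) =
    let (_ , r , nb) = normalise wb
    in  _ , slash* r , sSlash nb
  normaliseˢ wShift = _ , ε , sShift
  normaliseˢ wId    = _ , ε , sId
  normaliseˢ (wLift ws) =
    let (_ , r , ns) = normaliseˢ ws
    in  _ , lift* r , sLift ns

⇑^ : ℕ → Subst → Subst
⇑^ zero    s = s
⇑^ (suc k) s = ⇑ ⇑^ k s

-- Coherence laws for ↑ under k binders, on normal terms of scope at least k
-- (the bound k + m is what excludes the stuck terms x[⇑ s]).

shift-slash : ∀ k {m a} b → NF (k + m) a → a [ ⇑^ k ↑ ] [ ⇑^ k (b /) ] ⟶* a
shift-slash zero    b _            = return rShift
shift-slash (suc k) b nOne         = cClosL rVarLift ◅ return rVarLift
shift-slash (suc k) b (nApp na nb) =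
  cClosL rApp ◅ rApp ◅ app* (shift-slash (suc k) b na) (shift-slash (suc k) b nb)
shift-slash (suc k) b (nLam na)    =
  cClosL rLambda ◅ rLambda ◅ lam* (shift-slash (suc (suc k)) b na)
shift-slash (suc k) b (nSh na)     =
  cClosL rShiftLift ◅ rShiftLift ◅ closL* (shift-slash k b na)

shift-id : ∀ k {m a} → NF (k + m) a → Join (a [ ⇑^ k ↑ ] [ ⇑^ k id ]) (a [ ⇑^ k ↑ ])
shift-id zero    _    = _ , return rShiftId , ε
shift-id (suc k) nOne = _ , cClosL rVarLift ◅ return rVarLift , return rVarLift
shift-id (suc k) (nApp na nb) =
  let (_ , l₁ , r₁) = shift-id (suc k) na
      (_ , l₂ , r₂) = shift-id (suc k) nb
  in  _ , cClosL rApp ◅ rApp ◅ app* l₁ l₂ , rApp ◅ app* r₁ r₂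
shift-id (suc k) (nLam na) =
  let (_ , l , r) = shift-id (suc (suc k)) na
  in  _ , cClosL rLambda ◅ rLambda ◅ lam* l , rLambda ◅ lam* r
shift-id (suc k) (nSh na) =
  let (_ , l , r) = shift-id k na
  in  _ , cClosL rShiftLift ◅ rShiftLift ◅ closL* l , rShiftLift ◅ closL* r

shift-lift : ∀ k {m a} s → NF (k + m) a →
             Join (a [ ⇑^ k s ] [ ⇑^ k ↑ ]) (a [ ⇑^ k ↑ ] [ ⇑^ (suc k) s ])
shift-lift zero    s _    = _ , ε , return rShiftLift
shift-lift (suc k) s nOne = _ , cClosL rVarLift ◅ return rVarLift , cClosL rVarLift ◅ return rVarLift
shift-lift (suc k) s (nApp na nb) =
  let (_ , l₁ , r₁) = shift-lift (suc k) s na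
      (_ , l₂ , r₂) = shift-lift (suc k) s nb
  in  _ , cClosL rApp ◅ rApp ◅ app* l₁ l₂ , cClosL rApp ◅ rApp ◅ app* r₁ r₂
shift-lift (suc k) s (nLam na) =
  let (_ , l , r) = shift-lift (suc (suc k)) s na
  in  _ , cClosL rLambda ◅ rLambda ◅ lam* l , cClosL rLambda ◅ rLambda ◅ lam* r
shift-lift (suc k) s (nSh na) =
  let (_ , l , r) = shift-lift k s na
  in  _ , cClosL rShiftLift ◅ rShiftLift ◅ closL* l , cClosL rShiftLift ◅ rShiftLift ◅ closL* r

-- The same three laws, up to joinability, for every well-formed term:
-- normalise the term first and use that closures reduce with their body.

shift-slash-wf : ∀ k {m a} b → k + m ⊢ a → Join (a [ ⇑^ k ↑ ] [ ⇑^ k (b /) ]) a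
shift-slash-wf k b wa =
  let (a' , r , na) = normalise wa
  in  a' , closL* (closL* r) ◅◅ shift-slash k b na , r

shift-id-wf : ∀ k {m a} → k + m ⊢ a → Join (a [ ⇑^ k ↑ ] [ ⇑^ k id ]) (a [ ⇑^ k ↑ ])
shift-id-wf k wa =
  let (_ , r , na) = normalise wa
  in  join-expand (closL* (closL* r)) (closL* r) (shift-id k na)

shift-lift-wf : ∀ k {m a} s → k + m ⊢ a →
                Join (a [ ⇑^ k s ] [ ⇑^ k ↑ ]) (a [ ⇑^ k ↑ ] [ ⇑^ (suc k) s ])
shift-lift-wf k s wa =
  let (_ , r , na) = normalise wa
  in  join-expand (closL* (closL* r)) (closL* (closL* r)) (shift-lift k s na)

data Root : Term → Term → Set where
  RApp       : ∀ {a b s} → Root ((app a b) [ s ]) (app (a [ s ]) (b [ s ]))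
  RLambda    : ∀ {a s} → Root ((lam a) [ s ]) (lam (a [ ⇑ s ]))
  RVar       : ∀ {b} → Root (one [ b / ]) b
  RShift     : ∀ {a b} → Root (a [ ↑ ] [ b / ]) a
  RVarId     : Root (one [ id ]) one
  RShiftId   : ∀ {a} → Root (a [ ↑ ] [ id ]) (a [ ↑ ])
  RVarLift   : ∀ {s} → Root (one [ ⇑ s ]) one
  RShiftLift : ∀ {a s} → Root (a [ ↑ ] [ ⇑ s ]) (a [ s ] [ ↑ ])

-- The three critical pairs of a shift rule with Lambda on (λa)[↑]; the body a
-- has scope suc m, so the coherence laws apply with k = 1.

shift-lambda-peak : ∀ {m a} b → suc m ⊢ a → Join (lam a) ((lam (a [ ⇑ ↑ ])) [ b / ])
shift-lambda-peak b wa =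
  join-expand ε (return rLambda) (join-lam (join-sym (shift-slash-wf 1 b wa)))

shiftId-lambda-peak : ∀ {m a} → suc m ⊢ a → Join ((lam a) [ ↑ ]) ((lam (a [ ⇑ ↑ ])) [ id ])
shiftId-lambda-peak wa =
  join-expand (return rLambda) (return rLambda) (join-lam (join-sym (shift-id-wf 1 wa)))

shiftLift-lambda-peak : ∀ {m a} s → suc m ⊢ a →
                        Join ((lam a) [ s ] [ ↑ ]) ((lam (a [ ⇑ ↑ ])) [ ⇑ s ])
shiftLift-lambda-peak s wa =
  join-expand (cClosL rLambda ◅ return rLambda) (return rLambda)
              (join-lam (shift-lift-wf 1 s wa))

root-peak : ∀ {n a b c} → n ⊢ a → Root a b → a ⟶ c → Join b c
root-peak _ RApp rApp                  = _ , ε , ε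
root-peak _ RApp (cClosL (cAppL p))    = _ , return (cAppL (cClosL p)) , return rApp
root-peak _ RApp (cClosL (cAppR p))    = _ , return (cAppR (cClosL p)) , return rApp
root-peak _ RApp (cClosR p)            = _ , cAppL (cClosR p) ◅ return (cAppR (cClosR p)) , return rApp
root-peak _ RLambda rLambda            = _ , ε , ε
root-peak _ RLambda (cClosL (cLam p))  = _ , return (cLam (cClosL p)) , return rLambda
root-peak _ RLambda (cClosR p)         = _ , return (cLam (cClosR (cLift p))) , return rLambda
root-peak _ RVar rVar                  = _ , ε , ε
root-peak _ RVar (cClosR (cSlash p))   = _ , return p , return rVar
root-peak _ RShift rShift              = _ , ε , ε
root-peak _ RShift (cClosL rApp)       = _ , ε , rApp ◅ cAppL rShift ◅ return (cAppR rShift)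
root-peak (wClos _ (wClos _ (wLam wa))) (RShift {b = b}) (cClosL rLambda) =
  shift-lambda-peak b wa
root-peak _ RShift (cClosL (cClosL p)) = _ , return p , return rShift
root-peak _ RShift (cClosR (cSlash p)) = _ , ε , return rShift
root-peak _ RVarId rVarId              = _ , ε , ε
root-peak _ RShiftId rShiftId          = _ , ε , ε
root-peak _ RShiftId (cClosL rApp)     =
  _ , return rApp , rApp ◅ cAppL rShiftId ◅ return (cAppR rShiftId)
root-peak (wClos _ (wClos _ (wLam wa))) RShiftId (cClosL rLambda) =
  shiftId-lambda-peak wa
root-peak _ RShiftId (cClosL (cClosL p)) = _ , return (cClosL p) , return rShiftId
root-peak _ RVarLift rVarLift          = _ , ε , ε
root-peak _ RVarLift (cClosR (cLift p)) = _ , ε , return rVarLift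
root-peak _ RShiftLift rShiftLift      = _ , ε , ε
root-peak _ RShiftLift (cClosL rApp)   =
  _ , cClosL rApp ◅ return rApp , rApp ◅ cAppL rShiftLift ◅ return (cAppR rShiftLift)
root-peak (wClos _ (wClos _ (wLam wa))) (RShiftLift {s = s}) (cClosL rLambda) =
  shiftLift-lambda-peak s wa
root-peak _ RShiftLift (cClosL (cClosL p)) = _ , return (cClosL (cClosL p)) , return rShiftLift
root-peak _ RShiftLift (cClosR (cLift p))  = _ , return (cClosL (cClosR p)) , return rShiftLift

mutual
  local-confluence : ∀ {n a b c} → n ⊢ a → a ⟶ b → a ⟶ c → Join b c
  local-confluence w rApp       q = root-peak w RApp q
  local-confluence w rLambda    q = root-peak w RLambda q
  local-confluence w rVar       q = root-peak w RVar q
  local-confluence w rShift     q = root-peak w RShift q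
  local-confluence w rVarId     q = root-peak w RVarId q
  local-confluence w rShiftId   q = root-peak w RShiftId q
  local-confluence w rVarLift   q = root-peak w RVarLift q
  local-confluence w rShiftLift q = root-peak w RShiftLift q
  local-confluence w p rApp       = join-sym (root-peak w RApp p)
  local-confluence w p rLambda    = join-sym (root-peak w RLambda p)
  local-confluence w p rVar       = join-sym (root-peak w RVar p)
  local-confluence w p rShift     = join-sym (root-peak w RShift p)
  local-confluence w p rVarId     = join-sym (root-peak w RVarId p)
  local-confluence w p rShiftId   = join-sym (root-peak w RShiftId p)
  local-confluence w p rVarLift   = join-sym (root-peak w RVarLift p)
  local-confluence w p rShiftLift = join-sym (root-peak w RShiftLift p)
  local-confluence (wApp wa _) (cAppL p) (cAppL q) =
    let (_ , l , r) = local-confluence wa p q in _ , appL* l , appL* r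
  local-confluence _ (cAppL p) (cAppR q) = _ , return (cAppR q) , return (cAppL p)
  local-confluence _ (cAppR p) (cAppL q) = _ , return (cAppL q) , return (cAppR p)
  local-confluence (wApp _ wb) (cAppR p) (cAppR q) =
    let (_ , l , r) = local-confluence wb p q in _ , appR* l , appR* r
  local-confluence (wLam wa) (cLam p) (cLam q) = join-lam (local-confluence wa p q)
  local-confluence (wClos _ wa) (cClosL p) (cClosL q) =
    let (_ , l , r) = local-confluence wa p q in _ , closL* l , closL* r
  local-confluence _ (cClosL p) (cClosR q) = _ , return (cClosR q) , return (cClosL p)
  local-confluence _ (cClosR p) (cClosL q) = _ , return (cClosL q) , return (cClosR p)
  local-confluence (wClos ws _) (cClosR p) (cClosR q) =
    let (_ , l , r) = local-confluenceˢ ws p q in _ , closR* l , closR* r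

  local-confluenceˢ : ∀ {n m s s₁ s₂} → n ⊢ s ▷ m → s ⟶ˢ s₁ → s ⟶ˢ s₂ →
                      ∃ λ t → (s₁ ⟶ˢ* t) × (s₂ ⟶ˢ* t)
  local-confluenceˢ (wSlash wb) (cSlash p) (cSlash q) =
    let (_ , l , r) = local-confluence wb p q in _ , slash* l , slash* r
  local-confluenceˢ (wLift ws) (cLift p) (cLift q) =
    let (_ , l , r) = local-confluenceˢ ws p q in _ , lift* l , lift* r

mainTheorem17 : ∀ {a b c} → WellFormed a → a ⟶ b → a ⟶ c →
    ∃ λ d → (b ⟶* d) × (c ⟶* d)
mainTheorem17 (_ , w) p q = local-confluence w p q
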